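{- Let $T$ be a finite tree in which every top element has the same height, and let $\prec$ be a plane ordering on $\mathrm{Top}(T)$. Then $T$ has a plane drawing $d=(d_1,d_2)$ such that (i) the top elements are ordered left to right according to $\prec$, i.e. $d_1(t)<d_1(t')$ whenever $t,t'\in\mathrm{Top}(T)$ with $t\prec t'$, and (ii) $d_2(x)=\mathrm{height}(x)$ for every $x\in T$.
   Context: A finite tree is a finite poset with a least element (root) in which ${\downarrow}x=\{y\mid y\le x\}$ is a chain for every $x$. The height of a poset is the maximum of $|X|-1$ over chains $X$; the height of an element $x$ is the height of ${\downarrow}x$. $\mathrm{Top}(T)$ is the set of maximal elements. A linear order $\prec$ on $\mathrm{Top}(T)$ is a plane ordering if for every $x\in T$ the set $\{y\mid y\ge x\}\cap\mathrm{Top}(T)$ is an interval with respect to $\prec$. For a poset $G$, a plane drawing is an injection $d=(d_1,d_2)\colon G\to\mathbb{R}^2$ such that, drawing the straight segment (edge) between $d(x)$ and $d(y)$ whenever $y$ is an immediate successor of $x$ (i.e. $x<y$ with no $z$ such that $x<z<y$), we have: (a) $x<y$ implies $d_2(x)<d_2(y)$; (b) two distinct edges intersect only at common endpoints. -}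

module Defs where

open import Data.Nat as ℕ using (ℕ; suc)
open import Data.Fin using (Fin)
open import Data.List using (List; length)
open import Data.List.Relation.Unary.All using (All)
open import Data.List.Relation.Unary.Unique.Propositional using (Unique)
open import Data.Integer using (+_)
open import Data.Rational using (ℚ; _+_; _*_; _-_; _/_; 0ℚ; 1ℚ)
import Data.Rational as Q
open import Data.Product using (Σ; ∃; ∃-syntax; _×_; _,_; proj₁; proj₂)
open import Data.Sum using (_⊎_)
open import Relation.Nullary using (¬_)
open import Relation.Binary using (Decidable; Tri)
open import Relation.Binary.PropositionalEquality using (_≡_)
open import Function.Definitions using (Injective)

record FiniteTree (n : ℕ) : Set₁ where
  field
    _≤_      : Fin n → Fin n → Set
    ≤-dec    : Decidable _≤_
    ≤-refl   : ∀ x → x ≤ x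
    ≤-antisym : ∀ {x y} → x ≤ y → y ≤ x → x ≡ y
    ≤-trans  : ∀ {x y z} → x ≤ y → y ≤ z → x ≤ z
    root     : Fin n
    root-least : ∀ x → root ≤ x
    down-chain : ∀ x y z → y ≤ x → z ≤ x → (y ≤ z) ⊎ (z ≤ y)

module TreeNotions {n : ℕ} (T : FiniteTree n) where
  open FiniteTree T

  _<_ : Fin n → Fin n → Set
  x < y = x ≤ y × ¬ (x ≡ y)

  _⋖_ : Fin n → Fin n → Set
  x ⋖ y = x < y × (¬ (∃[ z ] (x < z × z < y)))

  IsTop : Fin n → Set
  IsTop x = ∀ y → x ≤ y → y ≡ x

  Down : Fin n → Fin n → Set
  Down x y = y ≤ x

  Up : Fin n → Fin n → Set
  Up x y = x ≤ y

  IsChainIn : (Fin n → Set) → List (Fin n) → Set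
  IsChainIn S X = Unique X × All S X × All (λ y → All (λ z → (y ≤ z) ⊎ (z ≤ y)) X) X

  -- the height of the subposet S is h: max over chains X ⊆ S of |X| - 1
  HeightIs : (Fin n → Set) → ℕ → Set
  HeightIs S h = (∃[ X ] (IsChainIn S X × length X ≡ suc h))
               × (∀ X → IsChainIn S X → length X ℕ.≤ suc h)

  ElemHeightIs : Fin n → ℕ → Set
  ElemHeightIs x h = HeightIs (Down x) h

  -- a plane ordering: a strict linear order ≺ on Top(T) such that
  -- for every x, ↑x ∩ Top(T) is an interval w.r.t. ≺
  record PlaneOrdering : Set₁ where
    field
      _≺_       : Fin n → Fin n → Set
      ≺-irrefl  : ∀ t → IsTop t → ¬ (t ≺ t)
      ≺-trans   : ∀ t t' t'' → IsTop t → IsTop t' → IsTop t'' → t ≺ t' → t' ≺ t'' → t ≺ t''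
      ≺-tri     : ∀ t t' → IsTop t → IsTop t' → Tri (t ≺ t') (t ≡ t') (t' ≺ t)
      interval  : ∀ x t s t' → IsTop t → IsTop s → IsTop t' →
                  x ≤ t → x ≤ t' → t ≺ s → s ≺ t' → x ≤ s

Point : Set
Point = ℚ × ℚ

OnSegment : Point → Point → Point → Set
OnSegment p a b = ∃[ λ' ] ((0ℚ Q.≤ λ') × (λ' Q.≤ 1ℚ)
  × (proj₁ p ≡ proj₁ a + λ' * (proj₁ b - proj₁ a))
  × (proj₂ p ≡ proj₂ a + λ' * (proj₂ b - proj₂ a)))

ℕtoℚ : ℕ → ℚ
ℕtoℚ h = + h / 1

module Drawing {n : ℕ} (T : FiniteTree n) where
  open FiniteTree T
  open TreeNotions T

  IsPlaneDrawing : (Fin n → Point) → Set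
  IsPlaneDrawing d =
      Injective _≡_ _≡_ d
    × (∀ x y → x < y → proj₂ (d x) Q.< proj₂ (d y))
    × (∀ x y x' y' → x ⋖ y → x' ⋖ y' → ¬ (x ≡ x' × y ≡ y') →
         ∀ p → OnSegment p (d x) (d y) → OnSegment p (d x') (d y') →
         ∃[ u ] ((u ≡ x ⊎ u ≡ y) × (u ≡ x' ⊎ u ≡ y') × p ≡ d u))

-- Draw x at (r x , height x), where r x is the number of tops to the left of a
-- chosen top above x. Distinct elements of equal height have no common upper
-- bound, so by the interval property every top above one of them lies left of
-- every top above the other; hence r is strictly increasing along each level,
-- and this order is inherited by the level above. Edges join consecutive
-- levels, so two edges meeting at an interior point would run between the same
-- two levels with strictly ordered endpoints at both ends, unless they share
-- their lower endpoint.
module Submission where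

open import Defs
open import Data.Nat as ℕ using (ℕ; suc; z≤n; s≤s)
import Data.Nat.Properties as ℕ
open import Data.Nat.Induction using (<-wellFounded)
open import Data.Integer as ℤ using (+_)
import Data.Integer.Properties as ℤ
open import Data.Rational as ℚ
  using (ℚ; mkℚ; ↥_; 0ℚ; 1ℚ; _+_; _*_; _-_; -_; *<*; *≤*; positive; nonNegative)
import Data.Rational.Properties as ℚ
import Data.Rational as Q
open import Data.Rational.Solver using (module +-*-Solver)
open import Algebra.Properties.Group ℚ.+-0-group using (∙-cancelˡ)
open import Data.Nat.Coprimality using (1-coprimeTo) renaming (sym to coprime-sym)
open import Data.Fin using (Fin; _≟_)
open import Data.Fin.Properties using (all?; any?)
open import Data.List using (List; []; _∷_; length; filter; allFin)
open import Data.List.Properties using (length-removeAt′)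
open import Data.List.Membership.Propositional using (_∈_; _─_)
open import Data.List.Membership.Propositional.Properties
  using (∈-filter⁺; ∈-filter⁻; ∈-allFin; ∈-length)
open import Data.List.Relation.Binary.Subset.Propositional using (_⊆_)
open import Data.List.Relation.Unary.All as All using (All; _∷_)
open import Data.List.Relation.Unary.Any using (here; there; index)
open import Data.List.Relation.Unary.Unique.Propositional using (Unique; _∷_)
open import Data.List.Relation.Unary.Unique.Propositional.Properties using (filter⁺; allFin⁺)
open import Data.Product using (∃; ∃-syntax; _×_; _,_; proj₁; proj₂)
open import Data.Sum using (_⊎_; inj₁; inj₂; [_,_]′)
open import Data.Empty using (⊥; ⊥-elim)
open import Function using (_∘_)
open import Induction.WellFounded using (Acc; acc)
open import Level using (Level)
open import Relation.Nullary using (¬_; Dec; yes; no; contradiction)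
open import Relation.Nullary.Decidable using (decidable-stable; _×-dec_; _→-dec_; ¬?)
open import Relation.Unary as U using (Pred; Decidable)
open import Relation.Binary using (Tri; tri<; tri≈; tri>)
open import Relation.Binary.PropositionalEquality
  using (_≡_; _≢_; refl; sym; trans; cong; cong₂; subst; subst₂; module ≡-Reasoning)

module _ {a : Level} {A : Set a} where

  ∈-─ : ∀ {x y : A} {ys} (y∈ys : y ∈ ys) → x ∈ ys → x ≢ y → x ∈ ys ─ y∈ys
  ∈-─ (here refl) (here refl) x≢y = contradiction refl x≢y
  ∈-─ (here refl) (there x∈ys) _ = x∈ys
  ∈-─ (there y∈ys) (here refl) _ = here refl
  ∈-─ (there y∈ys) (there x∈ys) x≢y = there (∈-─ y∈ys x∈ys x≢y)

  Unique⇒length≤ : ∀ {xs ys : List A} → Unique xs → xs ⊆ ys → length xs ℕ.≤ length ys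
  Unique⇒length≤ {[]} _ _ = z≤n
  Unique⇒length≤ {x ∷ xs} {ys} (x∉xs ∷ uxs) x∷xs⊆ys =
    subst (suc (length xs) ℕ.≤_) (sym (length-removeAt′ ys (index x∈ys)))
      (s≤s (Unique⇒length≤ uxs xs⊆ys─x))
    where
    x∈ys : x ∈ ys
    x∈ys = x∷xs⊆ys (here refl)
    xs⊆ys─x : xs ⊆ ys ─ x∈ys
    xs⊆ys─x z∈xs =
      ∈-─ x∈ys (x∷xs⊆ys (there z∈xs)) (λ { refl → All.lookup x∉xs z∈xs refl })

module _ {n : ℕ} {p : Level} {P : Pred (Fin n) p} (P? : Decidable P) where

  elements : List (Fin n)
  elements = filter P? (allFin n)

  count : ℕ
  count = length elements

  elements-unique : Unique elements
  elements-unique = filter⁺ P? (allFin⁺ n)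

  ∈-elements⁺ : ∀ {x} → P x → x ∈ elements
  ∈-elements⁺ {x} = ∈-filter⁺ P? (∈-allFin x)

  ∈-elements⁻ : ∀ {x} → x ∈ elements → P x
  ∈-elements⁻ x∈ = proj₂ (∈-filter⁻ P? {xs = allFin n} x∈)

  Unique⇒length≤count : ∀ {xs} → Unique xs → All P xs → length xs ℕ.≤ count
  Unique⇒length≤count u Pxs = Unique⇒length≤ u (∈-elements⁺ ∘ All.lookup Pxs)

module _ {n : ℕ} {p q : Level} {P : Pred (Fin n) p} {Q : Pred (Fin n) q}
         (P? : Decidable P) (Q? : Decidable Q) where

  count-< : P U.⊆ Q → ∀ {w} → Q w → ¬ P w → count P? ℕ.< count Q?
  count-< P⊆Q {w} Qw ¬Pw =
    Unique⇒length≤count Q? (w∉ ∷ elements-unique P?)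
      (Qw ∷ All.tabulate (P⊆Q ∘ ∈-elements⁻ P?))
    where
    w∉ : All (w ≢_) (elements P?)
    w∉ = All.tabulate λ { x∈ refl → ¬Pw (∈-elements⁻ P? x∈) }

  count-≤-suc : ∀ {y} → (∀ {x} → Q x → P x ⊎ x ≡ y) → count Q? ℕ.≤ suc (count P?)
  count-≤-suc {y} Q⊆P∪y =
    Unique⇒length≤ (elements-unique Q?) (into ∘ Q⊆P∪y ∘ ∈-elements⁻ Q?)
    where
    into : ∀ {x} → P x ⊎ x ≡ y → x ∈ y ∷ elements P?
    into (inj₁ Px) = there (∈-elements⁺ P? Px)
    into (inj₂ refl) = here refl

ℕtoℚ≡mkℚ : ∀ m → ℕtoℚ m ≡ mkℚ (+ m) 0 (coprime-sym (1-coprimeTo m))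
ℕtoℚ≡mkℚ m = ℚ.normalize-coprime (coprime-sym (1-coprimeTo m))

ℕtoℚ-suc : ∀ k → ℕtoℚ (suc k) ≡ ℕtoℚ k + 1ℚ
ℕtoℚ-suc k rewrite ℕtoℚ≡mkℚ k =
  -- the right-hand side now computes to ((+ k ℤ.* + 1) ℤ.+ + 1) / 1
  cong (ℚ._/ 1) (trans (cong +_ (ℕ.+-comm 1 k)) (cong (ℤ._+ + 1) (sym (ℤ.*-identityʳ (+ k)))))

ℕtoℚ-mono-≤ : ∀ {m k} → m ℕ.≤ k → ℕtoℚ m ℚ.≤ ℕtoℚ k
ℕtoℚ-mono-≤ {m} {k} m≤k rewrite ℕtoℚ≡mkℚ m | ℕtoℚ≡mkℚ k =
  *≤* (ℤ.*-monoʳ-≤-nonNeg (+ 1) (ℤ.+≤+ m≤k))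

ℕtoℚ-mono-< : ∀ {m k} → m ℕ.< k → ℕtoℚ m ℚ.< ℕtoℚ k
ℕtoℚ-mono-< {m} {k} m<k rewrite ℕtoℚ≡mkℚ m | ℕtoℚ≡mkℚ k =
  *<* (ℤ.*-monoʳ-<-pos (+ 1) (ℤ.+<+ m<k))

ℕtoℚ-injective : ∀ {m k} → ℕtoℚ m ≡ ℕtoℚ k → m ≡ k
ℕtoℚ-injective {m} {k} e rewrite ℕtoℚ≡mkℚ m | ℕtoℚ≡mkℚ k = ℤ.+-injective (cong ↥_ e)

+-cancelˡ : ∀ k {x y} → k + x ≡ k + y → x ≡ y
+-cancelˡ k = ∙-cancelˡ k _ _

lerp : ℚ → ℚ → ℚ → ℚ
lerp a b s = a + s * (b - a)

module _ where
  open +-*-Solver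

  lerp-0 : ∀ a b → lerp a b 0ℚ ≡ a
  lerp-0 = solve 2 (λ a b → a :+ con 0ℚ :* (b :- a) := a) refl

  lerp-1 : ∀ a b → lerp a b 1ℚ ≡ b
  lerp-1 = solve 2 (λ a b → a :+ con 1ℚ :* (b :- a) := b) refl

  lerp-convex : ∀ a b s → lerp a b s ≡ (1ℚ - s) * a + s * b
  lerp-convex = solve 3 (λ a b s → a :+ s :* (b :- a) := (con 1ℚ :- s) :* a :+ s :* b) refl

  lerp-unit : ∀ a s → lerp a (a + 1ℚ) s ≡ a + s
  lerp-unit = solve 2 (λ a s → a :+ s :* ((a :+ con 1ℚ) :- a) := a :+ s) refl

p≤q⇒0≤q-p : ∀ {p q} → p ℚ.≤ q → 0ℚ ℚ.≤ q - p
p≤q⇒0≤q-p {p} {q} p≤q = subst (ℚ._≤ q - p) (ℚ.+-inverseʳ p) (ℚ.+-monoˡ-≤ (- p) p≤q)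

lerp-monoˡ-≤ : ∀ {a a'} b {s} → s ℚ.≤ 1ℚ → a ℚ.≤ a' → lerp a b s ℚ.≤ lerp a' b s
lerp-monoˡ-≤ {a} {a'} b {s} s≤1 a≤a' =
  subst₂ ℚ._≤_ (sym (lerp-convex a b s)) (sym (lerp-convex a' b s))
    (ℚ.+-monoˡ-≤ (s * b)
      (ℚ.*-monoˡ-≤-nonNeg (1ℚ - s) {{nonNegative (p≤q⇒0≤q-p s≤1)}} a≤a'))

lerp-monoʳ-< : ∀ a {b b' s} → 0ℚ ℚ.< s → b ℚ.< b' → lerp a b s ℚ.< lerp a b' s
lerp-monoʳ-< a {s = s} 0<s b<b' =
  ℚ.+-monoʳ-< a (ℚ.*-monoʳ-<-pos s {{positive 0<s}} (ℚ.+-monoˡ-< (- a) b<b'))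

≤⇒≡⊎< : ∀ {p q} → p ℚ.≤ q → p ≡ q ⊎ p ℚ.< q
≤⇒≡⊎< {p} {q} p≤q with ℚ.<-cmp p q
... | tri< p<q _ _ = inj₂ p<q
... | tri≈ _ p≡q _ = inj₁ p≡q
... | tri> _ _ q<p = contradiction (ℚ.<-≤-trans q<p p≤q) (ℚ.<-irrefl refl)

lerp-mono-< : ∀ {a a' b b' s} → 0ℚ ℚ.≤ s → s ℚ.≤ 1ℚ → a ℚ.< a' → b ℚ.< b' →
              lerp a b s ℚ.< lerp a' b' s
lerp-mono-< {a} {a'} {b} {b'} {s} 0≤s s≤1 a<a' b<b' with ≤⇒≡⊎< 0≤s
... | inj₁ refl = subst₂ ℚ._<_ (sym (lerp-0 a b)) (sym (lerp-0 a' b')) a<a'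
... | inj₂ 0<s = ℚ.≤-<-trans (lerp-monoˡ-≤ b s≤1 (ℚ.<⇒≤ a<a')) (lerp-monoʳ-< a' 0<s b<b')

lerp-injectiveʳ : ∀ a {b b' s} → 0ℚ ℚ.< s → lerp a b s ≡ lerp a b' s → b ≡ b'
lerp-injectiveʳ a {b} {b'} 0<s e with ℚ.<-cmp b b'
... | tri< b<b' _ _ = contradiction e (ℚ.<⇒≢ (lerp-monoʳ-< a 0<s b<b'))
... | tri≈ _ b≡b' _ = b≡b'
... | tri> _ _ b'<b = contradiction (sym e) (ℚ.<⇒≢ (lerp-monoʳ-< a 0<s b'<b))

unit-intervals-meet : ∀ {K K' s s'} → K + 1ℚ ℚ.≤ K' → s ℚ.≤ 1ℚ → 0ℚ ℚ.≤ s' →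
                      K + s ≡ K' + s' → s ≡ 1ℚ × s' ≡ 0ℚ
unit-intervals-meet {K} {K'} {s} {s'} K+1≤K' s≤1 0≤s' e =
  +-cancelˡ K (ℚ.≤-antisym (ℚ.+-monoʳ-≤ K s≤1) K+1≤K+s) ,
  +-cancelˡ K' (ℚ.≤-antisym K'+s'≤K'+0 (ℚ.+-monoʳ-≤ K' 0≤s'))
  where
  open ℚ.≤-Reasoning
  K+1≤K+s : K + 1ℚ ℚ.≤ K + s
  K+1≤K+s = begin
    K + 1ℚ   ≤⟨ K+1≤K' ⟩
    K'       ≡⟨ sym (ℚ.+-identityʳ K') ⟩
    K' + 0ℚ  ≤⟨ ℚ.+-monoʳ-≤ K' 0≤s' ⟩
    K' + s'  ≡⟨ sym e ⟩
    K + s    ∎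
  K'+s'≤K'+0 : K' + s' ℚ.≤ K' + 0ℚ
  K'+s'≤K'+0 = begin
    K' + s'  ≡⟨ sym e ⟩
    K + s    ≤⟨ ℚ.+-monoʳ-≤ K s≤1 ⟩
    K + 1ℚ   ≤⟨ K+1≤K' ⟩
    K'       ≡⟨ sym (ℚ.+-identityʳ K') ⟩
    K' + 0ℚ  ∎

module Heights {n : ℕ} (T : FiniteTree n) where
  open FiniteTree T
  open TreeNotions T

  ∣↓_∣ : Fin n → ℕ
  ∣↓ x ∣ = count (λ z → ≤-dec z x)

  height : Fin n → ℕ
  height x = ℕ.pred ∣↓ x ∣

  ∣↓∣≡1+height : ∀ x → ∣↓ x ∣ ≡ suc (height x)
  ∣↓∣≡1+height x = sym (ℕ.suc-pred ∣↓ x ∣ {{ℕ.>-nonZero 0<∣↓x∣}})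
    where
    0<∣↓x∣ : 0 ℕ.< ∣↓ x ∣
    0<∣↓x∣ = ∈-length (∈-elements⁺ (λ z → ≤-dec z x) (≤-refl x))

  ∣↓∣-mono-< : ∀ {x y} → x < y → ∣↓ x ∣ ℕ.< ∣↓ y ∣
  ∣↓∣-mono-< {x} {y} (x≤y , x≢y) =
    count-< (λ z → ≤-dec z x) (λ z → ≤-dec z y) (λ z≤x → ≤-trans z≤x x≤y) (≤-refl y)
      (λ y≤x → x≢y (≤-antisym x≤y y≤x))

  height-mono-< : ∀ {x y} → x < y → height x ℕ.< height y
  height-mono-< {x} {y} x<y =
    ℕ.≤-pred (subst₂ ℕ._<_ (∣↓∣≡1+height x) (∣↓∣≡1+height y) (∣↓∣-mono-< x<y))

  ⋖⇒below : ∀ {x y z} → x ⋖ y → z ≤ y → z ≤ x ⊎ z ≡ y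
  ⋖⇒below {x} {y} {z} ((x≤y , _) , nothing-between) z≤y
    with down-chain y z x z≤y x≤y | z ≟ y | x ≟ z
  ... | inj₁ z≤x | _ | _ = inj₁ z≤x
  ... | inj₂ _ | yes z≡y | _ = inj₂ z≡y
  ... | inj₂ _ | no _ | yes refl = inj₁ (≤-refl x)
  ... | inj₂ x≤z | no z≢y | no x≢z = ⊥-elim (nothing-between (z , (x≤z , x≢z) , (z≤y , z≢y)))

  height-⋖ : ∀ {x y} → x ⋖ y → height y ≡ suc (height x)
  height-⋖ {x} {y} x⋖y = ℕ.suc-injective (begin
    suc (height y)  ≡⟨ sym (∣↓∣≡1+height y) ⟩
    ∣↓ y ∣          ≡⟨ ℕ.≤-antisym ∣↓y∣≤1+∣↓x∣ (∣↓∣-mono-< (proj₁ x⋖y)) ⟩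
    suc ∣↓ x ∣      ≡⟨ cong suc (∣↓∣≡1+height x) ⟩
    suc (suc (height x)) ∎)
    where
    open ≡-Reasoning
    ∣↓y∣≤1+∣↓x∣ : ∣↓ y ∣ ℕ.≤ suc ∣↓ x ∣
    ∣↓y∣≤1+∣↓x∣ = count-≤-suc (λ z → ≤-dec z x) (λ z → ≤-dec z y) (⋖⇒below x⋖y)

  ElemHeightIs⇒≡height : ∀ {x h} → ElemHeightIs x h → h ≡ height x
  ElemHeightIs⇒≡height {x} {h} ((X , (unique-X , X⊆↓x , _) , |X|≡1+h) , chains-bounded) =
    ℕ.suc-injective (trans (ℕ.≤-antisym 1+h≤∣↓x∣ ∣↓x∣≤1+h) (∣↓∣≡1+height x))
    where
    ↓x? : Decidable (Down x)
    ↓x? z = ≤-dec z x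
    ↓x : List (Fin n)
    ↓x = elements ↓x?
    ↓x-down : All (Down x) ↓x
    ↓x-down = All.tabulate (∈-elements⁻ ↓x?)
    1+h≤∣↓x∣ : suc h ℕ.≤ ∣↓ x ∣
    1+h≤∣↓x∣ = subst (ℕ._≤ ∣↓ x ∣) |X|≡1+h (Unique⇒length≤count ↓x? unique-X X⊆↓x)
    ∣↓x∣≤1+h : ∣↓ x ∣ ℕ.≤ suc h
    ∣↓x∣≤1+h = chains-bounded ↓x (elements-unique ↓x? , ↓x-down ,
      All.map (λ y≤x → All.map (λ z≤x → down-chain x _ _ y≤x z≤x) ↓x-down) ↓x-down)

  Disjoint↑ : Fin n → Fin n → Set
  Disjoint↑ x x' = ∀ {s} → x ≤ s → x' ≤ s → ⊥

  sameHeight⇒Disjoint↑ : ∀ {x x'} → height x ≡ height x' → x ≢ x' → Disjoint↑ x x'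
  sameHeight⇒Disjoint↑ {x} {x'} h≡h' x≢x' {s} x≤s x'≤s with down-chain s x x' x≤s x'≤s
  ... | inj₁ x≤x' = ℕ.<-irrefl h≡h' (height-mono-< (x≤x' , x≢x'))
  ... | inj₂ x'≤x = ℕ.<-irrefl (sym h≡h') (height-mono-< (x'≤x , x≢x' ∘ sym))

  IsTop? : Decidable IsTop
  IsTop? x = all? (λ y → ≤-dec x y →-dec (y ≟ x))

  ∣↑_∣ : Fin n → ℕ
  ∣↑ x ∣ = count (≤-dec x)

  ∣↑∣-anti-< : ∀ {x y} → x < y → ∣↑ y ∣ ℕ.< ∣↑ x ∣
  ∣↑∣-anti-< {x} {y} (x≤y , x≢y) =
    count-< (≤-dec y) (≤-dec x) (≤-trans x≤y) (≤-refl x)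
      (λ y≤x → x≢y (≤-antisym x≤y y≤x))

  top-above : ∀ x → ∃[ t ] (IsTop t × x ≤ t)
  top-above x = go x (<-wellFounded ∣↑ x ∣)
    where
    go : ∀ x → Acc ℕ._<_ ∣↑ x ∣ → ∃[ t ] (IsTop t × x ≤ t)
    go x (acc rs) with any? (λ y → ≤-dec x y ×-dec ¬? (x ≟ y))
    ... | yes (y , x<y) =
      let t , top , y≤t = go y (rs (∣↑∣-anti-< x<y)) in t , top , ≤-trans (proj₁ x<y) y≤t
    ... | no ∄x<y =
      x , (λ y x≤y → decidable-stable (y ≟ x) (λ y≢x → ∄x<y (y , x≤y , y≢x ∘ sym))) , ≤-refl x

module PlaneOrder {n : ℕ} (T : FiniteTree n) (P : TreeNotions.PlaneOrdering T) where
  open FiniteTree T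
  open TreeNotions T
  open PlaneOrdering P
  open Heights T

  Before : Fin n → Fin n → Set
  Before x x' = ∀ t t' → IsTop t → IsTop t' → x ≤ t → x' ≤ t' → t ≺ t'

  Before-mono : ∀ {x x' y y'} → Before x x' → x ≤ y → x' ≤ y' → Before y y'
  Before-mono B x≤y x'≤y' t t' top top' y≤t y'≤t' =
    B t t' top top' (≤-trans x≤y y≤t) (≤-trans x'≤y' y'≤t')

  Before-top : ∀ {t t'} → IsTop t → IsTop t' → t ≺ t' → Before t t'
  Before-top top top' t≺t' u u' _ _ t≤u t'≤u' with top u t≤u | top' u' t'≤u'
  ... | refl | refl = t≺t'

  Disjoint↑⇒Before : ∀ {x x' t₀ t₀'} → Disjoint↑ x x' → IsTop t₀ → IsTop t₀' →
                      x ≤ t₀ → x' ≤ t₀' → t₀ ≺ t₀' → Before x x'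
  Disjoint↑⇒Before {x} {x'} {t₀} {t₀'} disjoint top₀ top₀' x≤t₀ x'≤t₀' t₀≺t₀'
                   u u' top top' x≤u x'≤u' with ≺-tri u u' top top'
  ... | tri< u≺u' _ _ = u≺u'
  ... | tri≈ _ refl _ = ⊥-elim (disjoint x≤u x'≤u')
  ... | tri> _ _ u'≺u with ≺-tri t₀' u top₀' top
  ...   | tri< t₀'≺u _ _ =
    ⊥-elim (disjoint (interval x t₀ t₀' u top₀ top₀' top x≤t₀ x≤u t₀≺t₀' t₀'≺u) x'≤t₀')
  ...   | tri≈ _ refl _ = ⊥-elim (disjoint x≤u x'≤t₀')
  ...   | tri> _ _ u≺t₀' =
    ⊥-elim (disjoint x≤u (interval x' u' u t₀' top' top top₀' x'≤u' x'≤t₀' u'≺u u≺t₀'))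

  Disjoint↑⇒Before⊎Before : ∀ {x x'} → Disjoint↑ x x' → Before x x' ⊎ Before x' x
  Disjoint↑⇒Before⊎Before {x} {x'} disjoint
    with top-above x | top-above x'
  ... | t₀ , top₀ , x≤t₀ | t₀' , top₀' , x'≤t₀' with ≺-tri t₀ t₀' top₀ top₀'
  ...   | tri< t₀≺t₀' _ _ =
    inj₁ (Disjoint↑⇒Before disjoint top₀ top₀' x≤t₀ x'≤t₀' t₀≺t₀')
  ...   | tri≈ _ refl _ = ⊥-elim (disjoint x≤t₀ x'≤t₀')
  ...   | tri> _ _ t₀'≺t₀ =
    inj₂ (Disjoint↑⇒Before (λ x'≤s x≤s → disjoint x≤s x'≤s) top₀' top₀ x'≤t₀' x≤t₀ t₀'≺t₀)

  LeftOf : Fin n → Fin n → Set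
  LeftOf t s = IsTop s × s ≺ t

  LeftOf? : ∀ {t} → IsTop t → Decidable (LeftOf t)
  LeftOf? {t} top s with IsTop? s
  ... | no ¬top-s = no (¬top-s ∘ proj₁)
  ... | yes top-s with ≺-tri s t top-s top
  ...   | tri< s≺t _ _ = yes (top-s , s≺t)
  ...   | tri≈ ¬s≺t _ _ = no (¬s≺t ∘ proj₂)
  ...   | tri> ¬s≺t _ _ = no (¬s≺t ∘ proj₂)

  rank : ∀ {t} → IsTop t → ℕ
  rank top = count (LeftOf? top)

  rank-mono-< : ∀ {t t'} (top : IsTop t) (top' : IsTop t') → t ≺ t' → rank top ℕ.< rank top'
  rank-mono-< {t} {t'} top top' t≺t' =
    count-< (LeftOf? top) (LeftOf? top')
      (λ { (top-s , s≺t) → top-s , ≺-trans _ t t' top-s top top' s≺t t≺t' })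
      (top , t≺t') (≺-irrefl t top ∘ proj₂)

  leftRank : Fin n → ℕ
  leftRank x = rank (proj₁ (proj₂ (top-above x)))

  leftRank-mono-< : ∀ {x x'} → Before x x' → leftRank x ℕ.< leftRank x'
  leftRank-mono-< {x} {x'} B with top-above x | top-above x'
  ... | t , top , x≤t | t' , top' , x'≤t' = rank-mono-< top top' (B t t' top top' x≤t x'≤t')

  sameHeight⇒leftRank-< : ∀ {x x'} → height x ≡ height x' → x ≢ x' →
                           leftRank x ℕ.< leftRank x' ⊎ leftRank x' ℕ.< leftRank x
  sameHeight⇒leftRank-< h≡h' x≢x'
    with Disjoint↑⇒Before⊎Before (sameHeight⇒Disjoint↑ h≡h' x≢x')
  ... | inj₁ B = inj₁ (leftRank-mono-< B)
  ... | inj₂ B = inj₂ (leftRank-mono-< B)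

  leftRank-injective-on-levels : ∀ {x x'} → height x ≡ height x' →
                                 leftRank x ≡ leftRank x' → x ≡ x'
  leftRank-injective-on-levels {x} {x'} h≡h' r≡r' with x ≟ x'
  ... | yes x≡x' = x≡x'
  ... | no x≢x' with sameHeight⇒leftRank-< h≡h' x≢x'
  ...   | inj₁ r<r' = contradiction r≡r' (ℕ.<⇒≢ r<r')
  ...   | inj₂ r'<r = contradiction (sym r≡r') (ℕ.<⇒≢ r'<r)

module Embedding {n : ℕ} (T : FiniteTree n) (P : TreeNotions.PlaneOrdering T) where
  open FiniteTree T
  open TreeNotions T
  open Heights T
  open PlaneOrder T P

  X : Fin n → ℚ
  X x = ℕtoℚ (leftRank x)

  Y : Fin n → ℚ
  Y x = ℕtoℚ (height x)

  draw : Fin n → Point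
  draw x = X x , Y x

  draw-injective : ∀ {x x'} → draw x ≡ draw x' → x ≡ x'
  draw-injective e =
    leftRank-injective-on-levels (ℕtoℚ-injective (cong proj₂ e)) (ℕtoℚ-injective (cong proj₁ e))

  Y-⋖ : ∀ {x y} → x ⋖ y → Y y ≡ Y x + 1ℚ
  Y-⋖ {x} x⋖y = trans (cong ℕtoℚ (height-⋖ x⋖y)) (ℕtoℚ-suc (height x))

  OnEdge : Point → Fin n → Fin n → ℚ → Set
  OnEdge p x y s = 0ℚ ℚ.≤ s × s ℚ.≤ 1ℚ × proj₁ p ≡ lerp (X x) (X y) s × proj₂ p ≡ Y x + s

  OnSegment⇒OnEdge : ∀ {p x y} → x ⋖ y → OnSegment p (draw x) (draw y) → ∃[ s ] OnEdge p x y s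
  OnSegment⇒OnEdge {x = x} x⋖y (s , 0≤s , s≤1 , p₁ , p₂) =
    s , 0≤s , s≤1 , p₁ ,
    trans p₂ (trans (cong (λ b → lerp (Y x) b s) (Y-⋖ x⋖y)) (lerp-unit (Y x) s))

  OnEdge-start : ∀ {p x y s} → OnEdge p x y s → s ≡ 0ℚ → p ≡ draw x
  OnEdge-start {x = x} {y} (_ , _ , p₁ , p₂) refl =
    cong₂ _,_ (trans p₁ (lerp-0 (X x) (X y))) (trans p₂ (ℚ.+-identityʳ (Y x)))

  OnEdge-end : ∀ {p x y s} → x ⋖ y → OnEdge p x y s → s ≡ 1ℚ → p ≡ draw y
  OnEdge-end {x = x} {y} x⋖y (_ , _ , p₁ , p₂) refl =
    cong₂ _,_ (trans p₁ (lerp-1 (X x) (X y))) (trans p₂ (sym (Y-⋖ x⋖y)))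

  edges-on-lower-level : ∀ {p x y x' y' s s'} → x ⋖ y → height x ℕ.< height x' →
                         OnEdge p x y s → OnEdge p x' y' s' → y ≡ x' × p ≡ draw y
  edges-on-lower-level {p} {x} {y} {x'} {y'} {s} {s'} x⋖y h<h'
                       on@(_ , s≤1 , _ , p₂) on'@(0≤s' , _ , _ , p₂') =
    draw-injective (trans (sym p≡draw-y) p≡draw-x') , p≡draw-y
    where
    Yx+1≤Yx' : Y x + 1ℚ ℚ.≤ Y x'
    Yx+1≤Yx' = subst (ℚ._≤ Y x') (ℕtoℚ-suc (height x)) (ℕtoℚ-mono-≤ h<h')
    s≡1×s'≡0 : s ≡ 1ℚ × s' ≡ 0ℚ
    -- K and K' are given explicitly: inferring them makes Agda unfold height.
    s≡1×s'≡0 = unit-intervals-meet {Y x} {Y x'} Yx+1≤Yx' s≤1 0≤s' (trans (sym p₂) p₂')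
    p≡draw-y : p ≡ draw y
    p≡draw-y = OnEdge-end x⋖y on (proj₁ s≡1×s'≡0)
    p≡draw-x' : p ≡ draw x'
    p≡draw-x' = OnEdge-start on' (proj₂ s≡1×s'≡0)

  same-level⇒same-parameter : ∀ {p x y x' y' s s'} → height x ≡ height x' →
                               OnEdge p x y s → OnEdge p x' y' s' → s ≡ s'
  same-level⇒same-parameter {x = x} {s' = s'} h≡h' (_ , _ , _ , p₂) (_ , _ , _ , p₂') =
    +-cancelˡ (Y x) (trans (sym p₂) (trans p₂' (cong (λ h → ℕtoℚ h + s') (sym h≡h'))))

  fan-meets-at-root : ∀ {p x y y' s} → x ⋖ y → x ⋖ y' → y ≢ y' →
                      OnEdge p x y s → OnEdge p x y' s → s ≡ 0ℚ
  fan-meets-at-root {x = x} {y} {y'} {s} x⋖y x⋖y' y≢y' (0≤s , _ , p₁ , _) (_ , _ , p₁' , _) =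
    [ sym , (λ 0<s → contradiction (leftRank-injective-on-levels h≡h' (r≡r' 0<s)) y≢y') ]′
      (≤⇒≡⊎< 0≤s)
    where
    h≡h' : height y ≡ height y'
    h≡h' = trans (height-⋖ x⋖y) (sym (height-⋖ x⋖y'))
    r≡r' : 0ℚ ℚ.< s → leftRank y ≡ leftRank y'
    r≡r' 0<s = ℕtoℚ-injective (lerp-injectiveʳ (X x) {X y} {X y'} 0<s (trans (sym p₁) p₁'))

  parallel-edges-disjoint : ∀ {p x y x' y' s} → Before x x' → x ⋖ y → x' ⋖ y' →
                            OnEdge p x y s → OnEdge p x' y' s → ⊥
  parallel-edges-disjoint B ((x≤y , _) , _) ((x'≤y' , _) , _) (0≤s , s≤1 , p₁ , _) (_ , _ , p₁' , _) =
    ℚ.<-irrefl (trans (sym p₁) p₁')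
      (lerp-mono-< 0≤s s≤1 (ℕtoℚ-mono-< (leftRank-mono-< B))
        (ℕtoℚ-mono-< (leftRank-mono-< (Before-mono B x≤y x'≤y'))))

  edges-on-same-level : ∀ {p x y x' y' s} → x ⋖ y → x' ⋖ y' → ¬ (x ≡ x' × y ≡ y') →
                        height x ≡ height x' → Dec (x ≡ x') →
                        OnEdge p x y s → OnEdge p x' y' s → x ≡ x' × p ≡ draw x
  edges-on-same-level x⋖y x⋖y' distinct _ (yes refl) on on' =
    refl , OnEdge-start on (fan-meets-at-root x⋖y x⋖y' (distinct ∘ (refl ,_)) on on')
  edges-on-same-level x⋖y x'⋖y' _ h≡h' (no x≢x') on on' = ⊥-elim
    ([ (λ B → parallel-edges-disjoint B x⋖y x'⋖y' on on')
     , (λ B → parallel-edges-disjoint B x'⋖y' x⋖y on' on)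
     ]′ (Disjoint↑⇒Before⊎Before (sameHeight⇒Disjoint↑ h≡h' x≢x')))

  draw-planar : ∀ x y x' y' → x ⋖ y → x' ⋖ y' → ¬ (x ≡ x' × y ≡ y') →
                ∀ p → OnSegment p (draw x) (draw y) → OnSegment p (draw x') (draw y') →
                ∃[ u ] ((u ≡ x ⊎ u ≡ y) × (u ≡ x' ⊎ u ≡ y') × p ≡ draw u)
  draw-planar x y x' y' x⋖y x'⋖y' distinct p onSeg onSeg' =
    meet (OnSegment⇒OnEdge x⋖y onSeg) (OnSegment⇒OnEdge x'⋖y' onSeg') (ℕ.<-cmp (height x) (height x'))
    where
    meet : ∃ (OnEdge p x y) → ∃ (OnEdge p x' y') →
           Tri (height x ℕ.< height x') (height x ≡ height x') (height x' ℕ.< height x) →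
           ∃[ u ] ((u ≡ x ⊎ u ≡ y) × (u ≡ x' ⊎ u ≡ y') × p ≡ draw u)
    meet (_ , on) (_ , on') (tri< h<h' _ _) =
      let y≡x' , p≡draw-y = edges-on-lower-level x⋖y h<h' on on'
      in y , inj₂ refl , inj₁ y≡x' , p≡draw-y
    meet (_ , on) (_ , on') (tri> _ _ h'<h) =
      let y'≡x , p≡draw-y' = edges-on-lower-level x'⋖y' h'<h on' on
      in y' , inj₁ y'≡x , inj₂ refl , p≡draw-y'
    meet (_ , on) (_ , on') (tri≈ _ h≡h' _) =
      let x≡x' , p≡draw-x = edges-on-same-level x⋖y x'⋖y' distinct h≡h' (x ≟ x') on
                              (subst (OnEdge p x' y') (sym (same-level⇒same-parameter h≡h' on on')) on')
      in x , inj₁ refl , inj₁ x≡x' , p≡draw-x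

lemma7p5 : (n : ℕ) (T : FiniteTree n) →
    (∃[ h ] (∀ t → TreeNotions.IsTop T t → TreeNotions.ElemHeightIs T t h)) →
    (P : TreeNotions.PlaneOrdering T) →
    ∃[ d ] (Drawing.IsPlaneDrawing T d
      × (∀ t t' → TreeNotions.IsTop T t → TreeNotions.IsTop T t' →
           TreeNotions.PlaneOrdering._≺_ P t t' → proj₁ (d t) Q.< proj₁ (d t'))
      × (∀ x h → TreeNotions.ElemHeightIs T x h → proj₂ (d x) ≡ ℕtoℚ h))
lemma7p5 n T _ P =
  draw ,
  (draw-injective , (λ x y x<y → ℕtoℚ-mono-< (height-mono-< x<y)) , draw-planar) ,
  (λ t t' top top' t≺t' → ℕtoℚ-mono-< (leftRank-mono-< (Before-top top top' t≺t'))) ,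
  (λ x h x-has-height-h → cong ℕtoℚ (sym (ElemHeightIs⇒≡height x-has-height-h)))
  where
  open Heights T
  open PlaneOrder T P
  open Embedding T P
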